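{- For every $n\geqslant 6$, the decycling number $D(n)$ of the bubble-sort star graph $BS_n$ satisfies \[D(n)<\frac{n!}{2}-\left(\frac{n}{2}\right)!\quad\text{if } n \text{ is even},\qquad D(n)<\frac{n!}{2}-2\left(\frac{n-1}{2}\right)!+1\quad\text{if } n \text{ is odd}.\]
   Context: For $n\geqslant 3$, the bubble-sort star graph $BS_n$ has as vertices the $n!$ permutations $(u_1u_2\ldots u_n)$ of $\{1,2,\ldots,n\}$. Let $\mathcal{T}=\{(1,2),(1,3),\ldots,(1,n),(2,3),(3,4),\ldots,(n-1,n)\}$. Two vertices are adjacent iff one is obtained from the other by swapping the entries in positions $i$ and $j$ for some $(i,j)\in\mathcal{T}$. A decycling set of a graph $G$ is a set $D$ of vertices such that $G\setminus D$ is acyclic; the decycling number is the minimum cardinality of a decycling set. $D(n)$ denotes the decycling number of $BS_n$. -}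

module Defs where

open import Data.Nat using (ℕ; zero; suc; _≤_; _<_)
open import Data.Fin using (Fin; toℕ)
open import Data.Vec using (Vec; lookup; _[_]≔_)
open import Data.Vec.Membership.Propositional using () renaming (_∈_ to _∈ᵥ_)
open import Data.List using (List; []; _∷_; length; _++_; [_])
open import Data.List.Membership.Propositional using (_∉_)
open import Data.List.Relation.Unary.All using (All)
open import Data.List.Relation.Unary.Unique.Propositional using (Unique)
open import Data.Product using (Σ; _×_; ∃₂)
open import Data.Sum using (_⊎_)
open import Data.Unit using (⊤)
open import Relation.Binary.PropositionalEquality using (_≡_)
open import Relation.Nullary using (¬_)

-- Positions and entries are 0-indexed (Fin n) instead of 1..n.
-- A word of length n over Fin n; a vertex of BS_n is such a word that is a permutation.
Word : ℕ → Set
Word n = Vec (Fin n) n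

IsPerm : ∀ {n} → Word n → Set
IsPerm {n} u = ∀ (k : Fin n) → k ∈ᵥ u

swap : ∀ {n} → Fin n → Fin n → Word n → Word n
swap i j u = (u [ i ]≔ lookup u j) [ j ]≔ lookup u i

InT : ∀ {n} → Fin n → Fin n → Set
InT i j = (toℕ i ≡ 0 × 0 < toℕ j) ⊎ (1 ≤ toℕ i × toℕ j ≡ suc (toℕ i))

Adj : ∀ {n} → Word n → Word n → Set
Adj {n} u v = ∃₂ λ (i j : Fin n) → InT i j × v ≡ swap i j u

Chain : ∀ {n} → List (Word n) → Set
Chain [] = ⊤
Chain (x ∷ []) = ⊤
Chain (x ∷ y ∷ r) = Adj x y × Chain (y ∷ r)

CycleAvoiding : ∀ {n} → List (Word n) → Word n → List (Word n) → Set
CycleAvoiding D x r =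
  2 ≤ length r × Unique (x ∷ r) × All IsPerm (x ∷ r)
  × All (_∉ D) (x ∷ r) × Chain (x ∷ r ++ [ x ])

-- D (a finite set of vertices of BS_n, given as a duplicate-free list) is a
-- decycling set: BS_n minus D has no cycle
IsDecyclingSet : (n : ℕ) → List (Word n) → Set
IsDecyclingSet n D =
  Unique D × All IsPerm D × (∀ x r → ¬ CycleAvoiding D x r)

IsDecyclingNumber : ℕ → ℕ → Set
IsDecyclingNumber n d =
  Σ (List (Word n)) (λ D → IsDecyclingSet n D × length D ≡ d)
  × (∀ D → IsDecyclingSet n D → d ≤ length D)

-- BS_n is bipartite: each edge is a transposition and flips the parity of the number of inversions.
-- Let S be a set of even permutations no two of which have a common neighbour.  The even permutations
-- outside S form a decycling set: a cycle avoiding them alternates between odd vertices and elements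
-- of S, and two vertices two steps apart on it would be distinct elements of S with a common neighbour.
-- Hence D(n) ≤ n!/2 − |S|.
--
-- Such sets come from the permutations made of the blocks (2i, 2i+1) placed at positions (2a, 2a+1):
-- they are even, give every position a value of the same parity and start with a block, and two
-- permutations with the last two properties are never two transpositions apart.  For even n there are
-- (n/2)! of them, and a permutation with five positions of the wrong parity can be added, since two
-- transpositions change only four positions.  For odd n, appending n − 1 to each of them and adding
-- the copies with the entries at positions 2, 4, 6 rotated gives 2 · ((n − 1)/2)! of them.

module Submission where

open import Defs
open import Algebra.Bundles using (CommutativeRing)
open import Data.Bool using (Bool; true; false; not; _xor_)
import Data.Bool.Properties as Bool
open import Data.Bool.Properties
  using (T-≡; not-¬; not-involutive; not-distribˡ-xor; not-distribʳ-xor; xor-∧-commutativeRing)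
open import Algebra.Properties.CommutativeSemigroup
  (CommutativeRing.+-commutativeSemigroup xor-∧-commutativeRing) using (interchange; x∙yz≈y∙xz)
open import Data.Empty using (⊥; ⊥-elim)
open import Data.Unit using (⊤; tt)
open import Data.Fin using (Fin; zero; suc; toℕ; punchIn; punchOut; _≟_; inject₁; fromℕ; _↑ˡ_; #_)
import Data.Fin.Properties as Fin
open import Data.Fin.Properties
  using (toℕ-injective; punchOut-injective; injective⇒≤; toℕ-inject₁; toℕ-fromℕ; inject₁ℕ<; inject₁ℕ≤;
         inject₁-injective; fromℕ≢inject₁; ↑ˡ-injective; pigeonhole; punchIn-punchOut)
open import Data.Fin.Relation.Unary.Top using (view; ‵fromℕ; ‵inject₁)
open import Data.Nat using (ℕ; zero; suc; _+_; _*_; _∸_; _!; _<ᵇ_; _<_; _≤_; s≤s; z≤n)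
import Data.Nat.Properties as ℕ
open import Data.Nat.Properties
  using (m+n≤o⇒m≤o∸n; +-identityʳ; +-monoˡ-≤; +-mono-≤; +-suc; +-comm; *-assoc; <-irrefl; <-asym; 1+n≰n;
         <⇒<ᵇ; ≤-trans; ≤-reflexive; module ≤-Reasoning)
open import Data.Nat.DivMod using (_/_; _%_; m*n/n≡m; m*n%n≡0; [m+kn]%n≡m%n)
open import Data.Product using (Σ; ∃; ∃₂; _×_; _,_; proj₁; proj₂)
open import Data.Sum using (_⊎_; inj₁; inj₂)
open import Data.List using (List; []; _∷_; [_]; _++_; length; concatMap; allFin; filter; deduplicate)
import Data.List as List
open import Data.List.Properties using (length-++; length-map; length-tabulate; length-removeAt′; length-deduplicate)
import Data.List.Relation.Unary.All as All
open All using ([]; _∷_)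
open import Data.List.Relation.Unary.All.Properties using (filter⁺; deduplicate⁺)
open import Data.List.Relation.Unary.AllPairs using ([]; _∷_)
open import Data.List.Relation.Unary.Any using (here; there; satisfied; _─_) renaming (index to indexₗ)
open import Data.List.Relation.Unary.Unique.Propositional using (Unique)
open import Data.List.Relation.Unary.Unique.Propositional.Properties
  using (++⁺; allFin⁺) renaming (map⁺ to Unique-map⁺)
open import Data.List.Relation.Unary.Unique.DecPropositional.Properties using (deduplicate-!)
open import Data.List.Relation.Binary.Subset.Propositional using (_⊆_)
open import Data.List.Membership.Propositional using (_∈_; _∉_; find; lose)
open import Data.List.Membership.Propositional.Properties
  using (∈-++⁻; ∈-concatMap⁺; ∈-concatMap⁻; ∈-map⁺; ∈-map⁻; ∈-allFin; ∈-filter⁺; ∈-deduplicate⁺)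
import Data.List.Membership.DecPropositional as DecMembership
open import Data.Vec using (Vec; []; _∷_; lookup; _[_]≔_; tabulate; map; insertAt; removeAt)
open import Data.Vec.Properties
  using (≡-dec; lookup∘update; lookup∘update′; tabulate∘lookup; tabulate-cong; lookup-map; map-insertAt;
         insertAt-lookup; insertAt-punchIn; insertAt-removeAt; removeAt-insertAt; removeAt-punchOut;
         ∷-injectiveˡ; ∷-injectiveʳ)
open import Data.Vec.Relation.Unary.All using (All; []; _∷_)
import Data.Vec.Relation.Unary.All.Properties as Allᵥ
open import Data.Vec.Relation.Unary.Any using (index) renaming (here to hereᵥ; there to thereᵥ)
open import Data.Vec.Relation.Unary.Any.Properties using (lookup-index)
open import Data.Vec.Relation.Unary.Unique.Propositional using ([]; _∷_) renaming (Unique to Uniqueᵥ)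
open import Data.Vec.Relation.Unary.Unique.Propositional.Properties using (tabulate⁺)
open import Data.Vec.Membership.Propositional using () renaming (_∈_ to _∈ᵥ_)
open import Data.Vec.Membership.Propositional.Properties using (∈-lookup) renaming (∈-map⁺ to ∈ᵥ-map⁺)
open import Function using (_∘_)
open import Function.Bundles using (Equivalence)
open import Relation.Binary.PropositionalEquality hiding ([_])
open import Relation.Nullary using (¬_; Dec; yes; no; contradiction)
open import Relation.Unary using (Pred; Decidable)
open import Relation.Unary.Properties using (∁?)

private variable
  A B : Set
  k k′ m n : ℕ


odd : ℕ → Bool
odd zero = false
odd (suc n) = not (odd n)

xor-cancelˡ : ∀ a b → a xor (a xor b) ≡ b
xor-cancelˡ false b = refl
xor-cancelˡ true b = not-involutive b

<ᵇ-flip : ∀ a b → a ≢ b → (b <ᵇ a) ≡ not (a <ᵇ b)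
<ᵇ-flip zero zero a≢b = contradiction refl a≢b
<ᵇ-flip zero (suc b) _ = refl
<ᵇ-flip (suc a) zero _ = refl
<ᵇ-flip (suc a) (suc b) a≢b = <ᵇ-flip a b (a≢b ∘ cong suc)

<⇒<ᵇ≡true : ∀ {a b} → a < b → (a <ᵇ b) ≡ true
<⇒<ᵇ≡true a<b = Equivalence.to T-≡ (<⇒<ᵇ a<b)

≤⇒<ᵇ≡false : ∀ a b → b ≤ a → (a <ᵇ b) ≡ false
≤⇒<ᵇ≡false a zero _ = refl
≤⇒<ᵇ≡false (suc a) (suc b) (s≤s b≤a) = ≤⇒<ᵇ≡false a b b≤a


length-concatMap-const : ∀ (f : A → List B) xs h → (∀ x → length (f x) ≡ h) →
                         length (concatMap f xs) ≡ length xs * h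
length-concatMap-const f [] h _ = refl
length-concatMap-const f (x ∷ xs) h len =
  trans (length-++ (f x)) (cong₂ _+_ (len x) (length-concatMap-const f xs h len))

Unique-concatMap : ∀ (f : A → List B) {xs} → Unique xs → (∀ x → Unique (f x)) →
                   (∀ {x y z} → z ∈ f x → z ∈ f y → x ≡ y) → Unique (concatMap f xs)
Unique-concatMap f [] _ _ = []
Unique-concatMap f {x ∷ xs} (x∉xs ∷ xs-unique) f-unique f-disjoint =
  ++⁺ (f-unique x) (Unique-concatMap f xs-unique f-unique f-disjoint) λ (z∈fx , z∈rest) →
    let y , y∈xs , z∈fy = find (∈-concatMap⁻ f {xs = xs} z∈rest)
    in All.lookup x∉xs y∈xs (f-disjoint z∈fx z∈fy)

length-filter-∁ : ∀ {ℓ} {P : Pred A ℓ} (P? : Decidable P) xs →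
                  length (filter P? xs) + length (filter (∁? P?) xs) ≡ length xs
length-filter-∁ P? [] = refl
length-filter-∁ P? (x ∷ xs) with P? x
... | yes _ = cong suc (length-filter-∁ P? xs)
... | no _ =
  trans (+-suc (length (filter P? xs)) (length (filter (∁? P?) xs))) (cong suc (length-filter-∁ P? xs))

∈-─ : ∀ {x y : A} {ys} (x∈ys : x ∈ ys) → y ∈ ys → y ≢ x → y ∈ (ys ─ x∈ys)
∈-─ (here refl) (here refl) y≢x = contradiction refl y≢x
∈-─ (here _) (there y∈ys) _ = y∈ys
∈-─ (there _) (here y≡) _ = here y≡
∈-─ (there x∈ys) (there y∈ys) y≢x = there (∈-─ x∈ys y∈ys y≢x)

Unique-⊆⇒length≤ : ∀ {xs ys : List A} → Unique xs → xs ⊆ ys → length xs ≤ length ys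
Unique-⊆⇒length≤ {xs = []} _ _ = z≤n
Unique-⊆⇒length≤ {xs = x ∷ xs} {ys} (x∉xs ∷ xs-unique) xs⊆ys = ≤-trans
  (s≤s (Unique-⊆⇒length≤ xs-unique λ z∈xs →
    ∈-─ x∈ys (xs⊆ys (there z∈xs)) (All.lookup x∉xs z∈xs ∘ sym)))
  (≤-reflexive (sym (length-removeAt′ ys (indexₗ x∈ys))))
  where x∈ys = xs⊆ys (here refl)


-- Defs.swap over an arbitrary element type; Adj unfolds to it definitionally
swapᵥ : Fin m → Fin m → Vec A m → Vec A m
swapᵥ i j xs = (xs [ i ]≔ lookup xs j) [ j ]≔ lookup xs i

lookup-swapᵥ-left : ∀ (i j : Fin m) (xs : Vec A m) → lookup (swapᵥ i j xs) i ≡ lookup xs j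
lookup-swapᵥ-left i j xs with i ≟ j
... | yes refl = lookup∘update i (xs [ i ]≔ lookup xs i) (lookup xs i)
... | no i≢j =
  trans (lookup∘update′ i≢j (xs [ i ]≔ lookup xs j) (lookup xs i)) (lookup∘update i xs (lookup xs j))

lookup-swapᵥ-right : ∀ (i j : Fin m) (xs : Vec A m) → lookup (swapᵥ i j xs) j ≡ lookup xs i
lookup-swapᵥ-right i j xs = lookup∘update j (xs [ i ]≔ lookup xs j) (lookup xs i)

lookup-swapᵥ-other : ∀ (i j p : Fin m) (xs : Vec A m) → p ≢ i → p ≢ j →
                     lookup (swapᵥ i j xs) p ≡ lookup xs p
lookup-swapᵥ-other i j p xs p≢i p≢j =
  trans (lookup∘update′ p≢j (xs [ i ]≔ lookup xs j) (lookup xs i)) (lookup∘update′ p≢i xs (lookup xs j))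

swapᵥ-support : ∀ (i j p : Fin m) (xs : Vec A m) →
                p ≡ i ⊎ p ≡ j ⊎ lookup (swapᵥ i j xs) p ≡ lookup xs p
swapᵥ-support i j p xs with p ≟ i | p ≟ j
... | yes p≡i | _ = inj₁ p≡i
... | no _ | yes p≡j = inj₂ (inj₁ p≡j)
... | no p≢i | no p≢j = inj₂ (inj₂ (lookup-swapᵥ-other i j p xs p≢i p≢j))

lookup-extensionality : ∀ {xs ys : Vec A m} → (∀ p → lookup xs p ≡ lookup ys p) → xs ≡ ys
lookup-extensionality {xs = xs} {ys} eq = begin
  xs                   ≡⟨ tabulate∘lookup xs ⟨
  tabulate (lookup xs) ≡⟨ tabulate-cong eq ⟩
  tabulate (lookup ys) ≡⟨ tabulate∘lookup ys ⟩
  ys                   ∎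
  where open ≡-Reasoning

swapᵥ-involutive : ∀ (i j : Fin m) (xs : Vec A m) → swapᵥ i j (swapᵥ i j xs) ≡ xs
swapᵥ-involutive i j xs = lookup-extensionality pointwise
  where
  pointwise : ∀ p → lookup (swapᵥ i j (swapᵥ i j xs)) p ≡ lookup xs p
  pointwise p with p ≟ i | p ≟ j
  ... | yes refl | _ = trans (lookup-swapᵥ-left p j (swapᵥ p j xs)) (lookup-swapᵥ-right p j xs)
  ... | no _ | yes refl = trans (lookup-swapᵥ-right i p (swapᵥ i p xs)) (lookup-swapᵥ-left i p xs)
  ... | no p≢i | no p≢j =
    trans (lookup-swapᵥ-other i j p (swapᵥ i j xs) p≢i p≢j) (lookup-swapᵥ-other i j p xs p≢i p≢j)

lookup⇒∈ : ∀ (xs : Vec A m) p {x} → lookup xs p ≡ x → x ∈ᵥ xs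
lookup⇒∈ xs p refl = ∈-lookup p xs

pigeonhole-∈ᵥ : m < n → (xs : Vec A m) (f : Fin n → A) → (∀ {p q} → f p ≡ f q → p ≡ q) →
                ¬ (∀ p → f p ∈ᵥ xs)
pigeonhole-∈ᵥ m<n xs f f-injective covered with pigeonhole m<n (λ p → index (covered p))
... | p , q , p<q , same-index = <-irrefl (cong toℕ (f-injective (begin
  f p                           ≡⟨ lookup-index (covered p) ⟩
  lookup xs (index (covered p)) ≡⟨ cong (lookup xs) same-index ⟩
  lookup xs (index (covered q)) ≡⟨ lookup-index (covered q) ⟨
  f q                           ∎))) p<q
  where open ≡-Reasoning

map-inject₁-injective : ∀ {xs ys : Vec (Fin n) m} → map inject₁ xs ≡ map inject₁ ys → xs ≡ ys
map-inject₁-injective {xs = []} {[]} _ = refl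
map-inject₁-injective {xs = x ∷ xs} {y ∷ ys} eq =
  cong₂ _∷_ (inject₁-injective (∷-injectiveˡ eq)) (map-inject₁-injective (∷-injectiveʳ eq))

lookup-insertAt-fromℕ : ∀ (xs : Vec A n) v (q : Fin n) →
                        lookup (insertAt xs (fromℕ n) v) (inject₁ q) ≡ lookup xs q
lookup-insertAt-fromℕ (x ∷ xs) v zero = refl
lookup-insertAt-fromℕ (x ∷ xs) v (suc q) = lookup-insertAt-fromℕ xs v q

rightInverse⇒injective : (f g : Fin n → Fin n) → (∀ k → f (g k) ≡ k) →
                         ∀ a b → f a ≡ f b → a ≡ b
rightInverse⇒injective {suc n} f g fg a b fa≡fb with a ≟ b
... | yes a≡b = a≡b
-- g is injective and misses a or b, so punching the missed point out of g injects Fin (suc n) into Fin n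
... | no a≢b = contradiction (injective⇒≤ punchOut∘g-injective) 1+n≰n
  where
  g-injective : ∀ {x y} → g x ≡ g y → x ≡ y
  g-injective {x} {y} gx≡gy = trans (sym (fg x)) (trans (cong f gx≡gy) (fg y))
  missed : ∃ λ c → ∀ k → c ≢ g k
  missed with g (f a) ≟ a
  ... | yes gfa≡a = b , λ k b≡gk →
        a≢b (trans (sym gfa≡a) (trans (cong g (trans fa≡fb (trans (cong f b≡gk) (fg k)))) (sym b≡gk)))
  ... | no gfa≢a = a , λ k a≡gk → gfa≢a (trans (cong g (trans (cong f a≡gk) (fg k))) (sym a≡gk))
  punchOut∘g-injective : ∀ {x y} → punchOut (proj₂ missed x) ≡ punchOut (proj₂ missed y) → x ≡ y
  punchOut∘g-injective e = g-injective (punchOut-injective (proj₂ missed _) (proj₂ missed _) e)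


position : {u : Word n} → IsPerm u → Fin n → Fin n
position pu k = index (pu k)

lookup-position : {u : Word n} (pu : IsPerm u) (k : Fin n) → lookup u (position pu k) ≡ k
lookup-position pu k = sym (lookup-index (pu k))

perm-lookup-injective : {u : Word n} → IsPerm u → ∀ a b → lookup u a ≡ lookup u b → a ≡ b
perm-lookup-injective {u = u} pu = rightInverse⇒injective (lookup u) (position pu) (lookup-position pu)

perm⇒Uniqueᵥ : {u : Word n} → IsPerm u → Uniqueᵥ u
perm⇒Uniqueᵥ {u = u} pu =
  subst Uniqueᵥ (tabulate∘lookup u) (tabulate⁺ (λ {a} {b} → perm-lookup-injective pu a b))

perm-swapᵥ : ∀ (i j : Fin n) {u : Word n} → IsPerm u → IsPerm (swapᵥ i j u)
perm-swapᵥ i j {u} pu k with position pu k | lookup-position pu k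
... | p | up≡k with p ≟ i | p ≟ j
... | yes refl | _ = lookup⇒∈ (swapᵥ i j u) j (trans (lookup-swapᵥ-right p j u) up≡k)
... | no _ | yes refl = lookup⇒∈ (swapᵥ i j u) i (trans (lookup-swapᵥ-left i p u) up≡k)
... | no p≢i | no p≢j = lookup⇒∈ (swapᵥ i j u) p (trans (lookup-swapᵥ-other i j p u p≢i p≢j) up≡k)

identity : ∀ n → Word n
identity zero = []
identity (suc n) = zero ∷ map suc (identity n)

perm-identity : ∀ n → IsPerm (identity n)
perm-identity (suc n) zero = hereᵥ refl
perm-identity (suc n) (suc k) = thereᵥ (∈ᵥ-map⁺ suc (perm-identity n k))

_≟ᵂ_ : (u v : Word n) → Dec (u ≡ v)
_≟ᵂ_ = ≡-dec _≟_

Adj-sym : ∀ {u v : Word n} → Adj u v → Adj v u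
Adj-sym {u = u} (i , j , ij∈T , refl) = i , j , ij∈T , sym (swapᵥ-involutive i j u)

InT⇒< : ∀ {i j : Fin n} → InT i j → toℕ i < toℕ j
InT⇒< (inj₁ (i≡0 , 0<j)) = subst (_< _) (sym i≡0) 0<j
InT⇒< (inj₂ (_ , j≡1+i)) = ≤-reflexive (sym j≡1+i)


-- The sign of a permutation

oddBelow : Fin k → Vec (Fin k) m → Bool
oddBelow x [] = false
oddBelow x (y ∷ ys) = (toℕ y <ᵇ toℕ x) xor oddBelow x ys

oddInversions : Vec (Fin k) m → Bool
oddInversions [] = false
oddInversions (x ∷ xs) = oddBelow x xs xor oddInversions xs

oddBelow-update : ∀ (x y : Fin k) (ys : Vec (Fin k) m) j →
  (toℕ (lookup ys j) <ᵇ toℕ x) xor oddBelow x (ys [ j ]≔ y) ≡ (toℕ y <ᵇ toℕ x) xor oddBelow x ys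
oddBelow-update x y (z ∷ zs) zero = x∙yz≈y∙xz (toℕ z <ᵇ toℕ x) (toℕ y <ᵇ toℕ x) (oddBelow x zs)
oddBelow-update x y (z ∷ zs) (suc j) = begin
  z′ xor (z< xor oddBelow x (zs [ j ]≔ y)) ≡⟨ x∙yz≈y∙xz z′ z< (oddBelow x (zs [ j ]≔ y)) ⟩
  z< xor (z′ xor oddBelow x (zs [ j ]≔ y)) ≡⟨ cong (z< xor_) (oddBelow-update x y zs j) ⟩
  z< xor (y< xor oddBelow x zs)            ≡⟨ x∙yz≈y∙xz z< y< (oddBelow x zs) ⟩
  y< xor (z< xor oddBelow x zs)            ∎
  where
  open ≡-Reasoning
  z′ = toℕ (lookup zs j) <ᵇ toℕ x
  z< = toℕ z <ᵇ toℕ x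
  y< = toℕ y <ᵇ toℕ x

oddBelow-swapᵥ : ∀ (x : Fin k) (ys : Vec (Fin k) m) i j → oddBelow x (swapᵥ i j ys) ≡ oddBelow x ys
oddBelow-swapᵥ x (y ∷ ys) zero zero = refl
oddBelow-swapᵥ x (y ∷ ys) zero (suc j) = oddBelow-update x y ys j
oddBelow-swapᵥ x (y ∷ ys) (suc i) zero = oddBelow-update x y ys i
oddBelow-swapᵥ x (y ∷ ys) (suc i) (suc j) = cong ((toℕ y <ᵇ toℕ x) xor_) (oddBelow-swapᵥ x ys i j)

oddInversions-swapHead : ∀ (x y : Fin k) (xs : Vec (Fin k) m) → x ≢ y →
  oddInversions (y ∷ x ∷ xs) ≡ not (oddInversions (x ∷ y ∷ xs))
oddInversions-swapHead x y xs x≢y = begin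
  (x<y xor bʸ) xor (bˣ xor r)       ≡⟨ cong (λ c → (c xor bʸ) xor (bˣ xor r)) (<ᵇ-flip (toℕ y) (toℕ x) y≢x) ⟩
  (not y<x xor bʸ) xor (bˣ xor r)   ≡⟨ cong (_xor (bˣ xor r)) (not-distribˡ-xor y<x bʸ) ⟨
  not (y<x xor bʸ) xor (bˣ xor r)   ≡⟨ not-distribˡ-xor (y<x xor bʸ) (bˣ xor r) ⟨
  not ((y<x xor bʸ) xor (bˣ xor r)) ≡⟨ cong not (interchange y<x bʸ bˣ r) ⟩
  not ((y<x xor bˣ) xor (bʸ xor r)) ∎
  where
  open ≡-Reasoning
  x<y = toℕ x <ᵇ toℕ y
  y<x = toℕ y <ᵇ toℕ x
  bˣ = oddBelow x xs
  bʸ = oddBelow y xs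
  r = oddInversions xs
  y≢x = λ e → x≢y (toℕ-injective (sym e))

oddInversions-swapAdjacent : ∀ (i j : Fin m) → toℕ j ≡ suc (toℕ i) → (xs : Vec (Fin k) m) → Uniqueᵥ xs →
  oddInversions (swapᵥ i j xs) ≡ not (oddInversions xs)
oddInversions-swapAdjacent zero (suc zero) _ (x ∷ y ∷ zs) ((x≢y ∷ _) ∷ _) = oddInversions-swapHead x y zs x≢y
oddInversions-swapAdjacent (suc i) (suc j) j≡1+i (x ∷ ys) (_ ∷ ys-unique) = begin
  oddBelow x (swapᵥ i j ys) xor oddInversions (swapᵥ i j ys)
    ≡⟨ cong₂ _xor_ (oddBelow-swapᵥ x ys i j)
                   (oddInversions-swapAdjacent i j (ℕ.suc-injective j≡1+i) ys ys-unique) ⟩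
  oddBelow x ys xor not (oddInversions ys)
    ≡⟨ not-distribʳ-xor (oddBelow x ys) (oddInversions ys) ⟨
  not (oddBelow x ys xor oddInversions ys) ∎
  where open ≡-Reasoning

oddInversions-swapFirst : ∀ (x : Fin k) (xs : Vec (Fin k) m) j → Uniqueᵥ (x ∷ xs) →
  oddInversions (swapᵥ zero (suc j) (x ∷ xs)) ≡ not (oddInversions (x ∷ xs))
oddInversions-swapFirst x (z ∷ zs) zero ((x≢z ∷ _) ∷ _) = oddInversions-swapHead x z zs x≢z
oddInversions-swapFirst x (z ∷ zs) (suc j) ((x≢z ∷ x∉zs) ∷ (z∉zs ∷ zs-unique)) = begin
  oddInversions (a ∷ z ∷ W)
    ≡⟨ oddInversions-swapHead z a W (Allᵥ.lookup⁺ z∉zs j) ⟩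
  not (((toℕ a <ᵇ toℕ z) xor oddBelow z W) xor oddInversions (a ∷ W))
    ≡⟨ cong not (cong₂ _xor_ (oddBelow-update z x zs j)
                              (oddInversions-swapFirst x zs j (x∉zs ∷ zs-unique))) ⟩
  not (oddBelow z (x ∷ zs) xor not (oddInversions (x ∷ zs)))
    ≡⟨ cong not (not-distribʳ-xor (oddBelow z (x ∷ zs)) (oddInversions (x ∷ zs))) ⟨
  not (not (oddInversions (z ∷ x ∷ zs)))
    ≡⟨ not-involutive (oddInversions (z ∷ x ∷ zs)) ⟩
  oddInversions (z ∷ x ∷ zs)
    ≡⟨ oddInversions-swapHead x z zs x≢z ⟩
  not (oddInversions (x ∷ z ∷ zs)) ∎
  where
  open ≡-Reasoning
  -- exchange the first two entries; then a ∷ W is x ∷ zs with positions 0 and j + 1 swapped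
  a = lookup zs j
  W = zs [ j ]≔ x

oddInversions-Adj : ∀ {u v : Word n} → Adj u v → Uniqueᵥ u → oddInversions v ≡ not (oddInversions u)
oddInversions-Adj {u = x ∷ xs} (zero , suc j , inj₁ _ , refl) u-unique = oddInversions-swapFirst x xs j u-unique
oddInversions-Adj {u = u} (i , j , inj₂ (_ , j≡1+i) , refl) u-unique =
  oddInversions-swapAdjacent i j j≡1+i u u-unique

adjacent-parity : ∀ {u v : Word n} → IsPerm u → Adj u v → oddInversions v ≡ not (oddInversions u)
adjacent-parity pu u~v = oddInversions-Adj u~v (perm⇒Uniqueᵥ pu)

oddInversions-swapᵥ² : ∀ (i j k l : Fin n) {u : Word n} → IsPerm u → InT i j → InT k l →
                       oddInversions (swapᵥ k l (swapᵥ i j u)) ≡ oddInversions u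
oddInversions-swapᵥ² i j k l {u} pu ij∈T kl∈T = begin
  oddInversions (swapᵥ k l (swapᵥ i j u)) ≡⟨ adjacent-parity (perm-swapᵥ i j pu) (k , l , kl∈T , refl) ⟩
  not (oddInversions (swapᵥ i j u))       ≡⟨ cong not (adjacent-parity pu (i , j , ij∈T , refl)) ⟩
  not (not (oddInversions u))             ≡⟨ not-involutive (oddInversions u) ⟩
  oddInversions u                         ∎
  where open ≡-Reasoning

oddBelow-map-suc : ∀ (x : Fin k) (ys : Vec (Fin k) m) → oddBelow (suc x) (map suc ys) ≡ oddBelow x ys
oddBelow-map-suc x [] = refl
oddBelow-map-suc x (y ∷ ys) = cong ((toℕ y <ᵇ toℕ x) xor_) (oddBelow-map-suc x ys)

oddInversions-map-suc : ∀ (ys : Vec (Fin k) m) → oddInversions (map suc ys) ≡ oddInversions ys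
oddInversions-map-suc [] = refl
oddInversions-map-suc (y ∷ ys) = cong₂ _xor_ (oddBelow-map-suc y ys) (oddInversions-map-suc ys)

oddBelow-zero : ∀ (ys : Vec (Fin (suc k)) m) → oddBelow zero ys ≡ false
oddBelow-zero [] = refl
oddBelow-zero (y ∷ ys) = oddBelow-zero ys

oddInversions-identity : ∀ n → oddInversions (identity n) ≡ false
oddInversions-identity zero = refl
oddInversions-identity (suc n) =
  cong₂ _xor_ (oddBelow-zero (map suc (identity n)))
              (trans (oddInversions-map-suc (identity n)) (oddInversions-identity n))


-- Inserting the largest letter

positionsAfter : Fin (suc n) → ℕ
positionsAfter {n} zero = n
positionsAfter {suc n} (suc p) = positionsAfter {n} p

insertMax : Fin (suc n) → Word n → Word (suc n)
insertMax {n} p w = insertAt (map inject₁ w) p (fromℕ n)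

oddBelow-inject₁ : ∀ (x : Fin n) (ys : Vec (Fin n) m) → oddBelow (inject₁ x) (map inject₁ ys) ≡ oddBelow x ys
oddBelow-inject₁ x [] = refl
oddBelow-inject₁ x (y ∷ ys) =
  cong₂ _xor_ (cong₂ _<ᵇ_ (toℕ-inject₁ y) (toℕ-inject₁ x)) (oddBelow-inject₁ x ys)

oddInversions-inject₁ : ∀ (ys : Vec (Fin n) m) → oddInversions (map inject₁ ys) ≡ oddInversions ys
oddInversions-inject₁ [] = refl
oddInversions-inject₁ (y ∷ ys) = cong₂ _xor_ (oddBelow-inject₁ y ys) (oddInversions-inject₁ ys)

oddBelow-fromℕ : ∀ (ys : Vec (Fin n) m) → oddBelow (fromℕ n) (map inject₁ ys) ≡ odd m
oddBelow-fromℕ [] = refl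
oddBelow-fromℕ {n} (y ∷ ys) = cong₂ _xor_ y<n (oddBelow-fromℕ ys)
  where
  y<n : (toℕ (inject₁ y) <ᵇ toℕ (fromℕ n)) ≡ true
  y<n = trans (cong (toℕ (inject₁ y) <ᵇ_) (toℕ-fromℕ n)) (<⇒<ᵇ≡true (inject₁ℕ< y))

oddBelow-insertAt-fromℕ : ∀ (x : Fin n) (ys : Vec (Fin n) m) p →
  oddBelow (inject₁ x) (insertAt (map inject₁ ys) p (fromℕ n)) ≡ oddBelow x ys
oddBelow-insertAt-fromℕ {n} x ys zero = cong₂ _xor_ n≮x (oddBelow-inject₁ x ys)
  where
  n≮x : (toℕ (fromℕ n) <ᵇ toℕ (inject₁ x)) ≡ false
  n≮x = trans (cong (_<ᵇ toℕ (inject₁ x)) (toℕ-fromℕ n)) (≤⇒<ᵇ≡false n _ (inject₁ℕ≤ x))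
oddBelow-insertAt-fromℕ x (y ∷ ys) (suc p) =
  cong₂ _xor_ (cong₂ _<ᵇ_ (toℕ-inject₁ y) (toℕ-inject₁ x)) (oddBelow-insertAt-fromℕ x ys p)

oddInversions-insertAt-fromℕ : ∀ (ys : Vec (Fin n) m) p →
  oddInversions (insertAt (map inject₁ ys) p (fromℕ n)) ≡ odd (positionsAfter p) xor oddInversions ys
oddInversions-insertAt-fromℕ ys zero = cong₂ _xor_ (oddBelow-fromℕ ys) (oddInversions-inject₁ ys)
oddInversions-insertAt-fromℕ (y ∷ ys) (suc p) = begin
  oddBelow (inject₁ y) (insertAt (map inject₁ ys) p _) xor oddInversions (insertAt (map inject₁ ys) p _)
    ≡⟨ cong₂ _xor_ (oddBelow-insertAt-fromℕ y ys p) (oddInversions-insertAt-fromℕ ys p) ⟩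
  oddBelow y ys xor (odd (positionsAfter p) xor oddInversions ys)
    ≡⟨ x∙yz≈y∙xz (oddBelow y ys) (odd (positionsAfter p)) (oddInversions ys) ⟩
  odd (positionsAfter p) xor oddInversions (y ∷ ys) ∎
  where open ≡-Reasoning

-- the new maximum forms an inversion with exactly the entries after it
oddInversions-insertMax : ∀ (p : Fin (suc n)) (w : Word n) →
  oddInversions (insertMax p w) ≡ odd (positionsAfter p) xor oddInversions w
oddInversions-insertMax p w = oddInversions-insertAt-fromℕ w p

perm-insertMax : ∀ (p : Fin (suc n)) {w : Word n} → IsPerm w → IsPerm (insertMax p w)
perm-insertMax {n} p {w} pw k with view k
... | ‵fromℕ = lookup⇒∈ (insertMax p w) p (insertAt-lookup (map inject₁ w) p (fromℕ n))
... | ‵inject₁ i = lookup⇒∈ (insertMax p w) (punchIn p (position pw i)) (begin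
  lookup (insertMax p w) (punchIn p (position pw i)) ≡⟨ insertAt-punchIn (map inject₁ w) p (fromℕ n) _ ⟩
  lookup (map inject₁ w) (position pw i)             ≡⟨ lookup-map (position pw i) inject₁ w ⟩
  inject₁ (lookup w (position pw i))                 ≡⟨ cong inject₁ (lookup-position pw i) ⟩
  inject₁ i                                          ∎)
  where open ≡-Reasoning

insertMax-injective : ∀ {p p′ : Fin (suc n)} {w w′ : Word n} →
                      insertMax p w ≡ insertMax p′ w′ → p ≡ p′ × w ≡ w′
insertMax-injective {n} {p} {p′} {w} {w′} eq with p ≟ p′
... | yes refl = refl , map-inject₁-injective (begin
  map inject₁ w                             ≡⟨ removeAt-insertAt (map inject₁ w) p (fromℕ n) ⟨
  removeAt (insertMax p w) p                ≡⟨ cong (λ v → removeAt v p) eq ⟩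
  removeAt (insertMax p w′) p               ≡⟨ removeAt-insertAt (map inject₁ w′) p (fromℕ n) ⟩
  map inject₁ w′                            ∎)
  where open ≡-Reasoning
... | no p≢p′ = contradiction (begin
  fromℕ n                                   ≡⟨ insertAt-lookup (map inject₁ w) p (fromℕ n) ⟨
  lookup (insertMax p w) p                  ≡⟨ cong (λ v → lookup v p) eq ⟩
  lookup (insertMax p′ w′) p                ≡⟨ cong (lookup (insertMax p′ w′)) (punchIn-punchOut p′≢p) ⟨
  lookup (insertMax p′ w′) (punchIn p′ q)   ≡⟨ insertAt-punchIn (map inject₁ w′) p′ (fromℕ n) q ⟩
  lookup (map inject₁ w′) q                 ≡⟨ lookup-map q inject₁ w′ ⟩
  inject₁ (lookup w′ q)                     ∎) fromℕ≢inject₁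
  where
  open ≡-Reasoning
  p′≢p = p≢p′ ∘ sym
  q = punchOut p′≢p

removeAt-excludes-lookup : ∀ (xs : Vec A (suc m)) p → Uniqueᵥ xs → All (lookup xs p ≢_) (removeAt xs p)
removeAt-excludes-lookup (x ∷ xs) zero (x∉xs ∷ _) = x∉xs
removeAt-excludes-lookup (x ∷ y ∷ ys) (suc i) (x∉ ∷ y∷ys-unique) =
  (λ e → Allᵥ.lookup⁺ x∉ i (sym e)) ∷ removeAt-excludes-lookup (y ∷ ys) i y∷ys-unique

map-inject₁-surjective : ∀ (ys : Vec (Fin (suc n)) m) → All (fromℕ n ≢_) ys →
                         ∃ λ xs → map inject₁ xs ≡ ys
map-inject₁-surjective [] [] = [] , refl
map-inject₁-surjective (y ∷ ys) (n≢y ∷ n∉ys) with view y | map-inject₁-surjective ys n∉ys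
... | ‵fromℕ | _ = contradiction refl n≢y
... | ‵inject₁ i | xs , eq = i ∷ xs , cong (inject₁ i ∷_) eq

perm⇒insertMax : ∀ {u : Word (suc n)} → IsPerm u → ∃₂ λ p w → IsPerm w × u ≡ insertMax p w
perm⇒insertMax {n} {u} pu = p , w , pw , u≡
  where
  p = position pu (fromℕ n)
  lowered = map-inject₁-surjective (removeAt u p)
              (subst (λ x → All (x ≢_) (removeAt u p)) (lookup-position pu (fromℕ n))
                     (removeAt-excludes-lookup u p (perm⇒Uniqueᵥ pu)))
  w = proj₁ lowered
  map-w≡ = proj₂ lowered
  u≡ : u ≡ insertMax p w
  u≡ = sym (begin
    insertAt (map inject₁ w) p (fromℕ n)
      ≡⟨ cong₂ (λ r x → insertAt r p x) map-w≡ (sym (lookup-position pu (fromℕ n))) ⟩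
    insertAt (removeAt u p) p (lookup u p) ≡⟨ insertAt-removeAt u p ⟩
    u                                      ∎)
    where open ≡-Reasoning
  pw : IsPerm w
  pw k = lookup⇒∈ w (punchOut p≢q) (inject₁-injective (begin
    inject₁ (lookup w (punchOut p≢q))     ≡⟨ lookup-map (punchOut p≢q) inject₁ w ⟨
    lookup (map inject₁ w) (punchOut p≢q) ≡⟨ cong (λ r → lookup r (punchOut p≢q)) map-w≡ ⟩
    lookup (removeAt u p) (punchOut p≢q)  ≡⟨ removeAt-punchOut u p≢q ⟩
    lookup u q                            ≡⟨ lookup-position pu (inject₁ k) ⟩
    inject₁ k                             ∎))
    where
    open ≡-Reasoning
    q = position pu (inject₁ k)
    p≢q : p ≢ q
    p≢q p≡q = fromℕ≢inject₁ (begin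
      fromℕ n    ≡⟨ lookup-position pu (fromℕ n) ⟨
      lookup u p ≡⟨ cong (lookup u) p≡q ⟩
      lookup u q ≡⟨ lookup-position pu (inject₁ k) ⟩
      inject₁ k  ∎)


-- Enumerating the permutations of each parity

permsOfParity : (n : ℕ) → Bool → List (Word n)
permsWithMaxAt : Fin (suc n) → Bool → List (Word (suc n))

permsOfParity zero false = [ [] ]
permsOfParity zero true = []
permsOfParity (suc n) b = concatMap (λ p → permsWithMaxAt p b) (allFin (suc n))

permsWithMaxAt {n} p b = List.map (insertMax p) (permsOfParity n (odd (positionsAfter p) xor b))

permsOfParity-sound : ∀ n b {u : Word n} → u ∈ permsOfParity n b → IsPerm u × oddInversions u ≡ b
permsOfParity-sound zero false (here refl) = (λ ()) , refl
permsOfParity-sound (suc n) b u∈ with satisfied (∈-concatMap⁻ _ {xs = allFin (suc n)} u∈)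
... | p , u∈block with ∈-map⁻ (insertMax p) u∈block
... | w , w∈ , refl with permsOfParity-sound n (odd (positionsAfter p) xor b) w∈
... | pw , oddw = perm-insertMax p pw , (begin
  oddInversions (insertMax p w)       ≡⟨ oddInversions-insertMax p w ⟩
  o xor oddInversions w               ≡⟨ cong (o xor_) oddw ⟩
  o xor (o xor b)                     ≡⟨ xor-cancelˡ o b ⟩
  b                                   ∎)
  where
  open ≡-Reasoning
  o = odd (positionsAfter p)

permsOfParity-complete : ∀ n {u : Word n} → IsPerm u → u ∈ permsOfParity n (oddInversions u)
permsOfParity-complete zero {[]} _ = here refl
permsOfParity-complete (suc n) pu with perm⇒insertMax pu
... | p , w , pw , refl = ∈-concatMap⁺ _ (lose (∈-allFin p) (∈-map⁺ (insertMax p) w∈))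
  where
  o = odd (positionsAfter p)
  w∈ : w ∈ permsOfParity n (o xor oddInversions (insertMax p w))
  w∈ = subst (λ b → w ∈ permsOfParity n b)
             (sym (trans (cong (o xor_) (oddInversions-insertMax p w)) (xor-cancelˡ o (oddInversions w))))
             (permsOfParity-complete n pw)

halfFactorial : ℕ → ℕ
halfFactorial zero = 1
halfFactorial (suc k) = (3 + k) * halfFactorial k

halfFactorial-*2 : ∀ k → halfFactorial k * 2 ≡ (2 + k) !
halfFactorial-*2 zero = refl
halfFactorial-*2 (suc k) = trans (*-assoc (3 + k) (halfFactorial k) 2) (cong ((3 + k) *_) (halfFactorial-*2 k))

length-permsOfParity : ∀ k b → length (permsOfParity (2 + k) b) ≡ halfFactorial k
length-permsOfParity zero false = refl
length-permsOfParity zero true = refl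
length-permsOfParity (suc k) b = begin
  length (permsOfParity (3 + k) b)
    ≡⟨ length-concatMap-const (λ p → permsWithMaxAt p b) (allFin (3 + k)) (halfFactorial k) length-block ⟩
  length (allFin (3 + k)) * halfFactorial k
    ≡⟨ cong (_* halfFactorial k) (length-tabulate {n = 3 + k} (λ i → i)) ⟩
  (3 + k) * halfFactorial k ∎
  where
  open ≡-Reasoning
  length-block : ∀ p → length (permsWithMaxAt p b) ≡ halfFactorial k
  length-block p = trans (length-map (insertMax p) (permsOfParity (2 + k) (odd (positionsAfter p) xor b)))
                         (length-permsOfParity k (odd (positionsAfter p) xor b))


-- Scattered sets of even permutations

NoCommonNeighbour : List (Word n) → Set
NoCommonNeighbour S = ∀ {a b c} → a ∈ S → b ∈ S → Adj a c → Adj c b → a ≡ b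

record ScatteredEvenSet (n : ℕ) : Set where
  field
    vertices : List (Word n)
    vertices-unique : Unique vertices
    vertices-even : ∀ {s} → s ∈ vertices → IsPerm s × oddInversions s ≡ false
    vertices-scattered : NoCommonNeighbour vertices

module _ {n} (scattered : ScatteredEvenSet n) where

  open ScatteredEvenSet scattered renaming
    (vertices to S; vertices-unique to S-unique; vertices-even to S-even; vertices-scattered to S-scattered)
  open DecMembership (_≟ᵂ_ {n}) using (_∈?_; _∉?_)

  private
    evens = permsOfParity n false
    D = deduplicate _≟ᵂ_ (filter (_∉? S) evens)

    even∉D⇒∈S : ∀ {v} → IsPerm v → oddInversions v ≡ false → v ∉ D → v ∈ S
    even∉D⇒∈S {v} pv v-even v∉D with v ∈? S
    ... | yes v∈S = v∈S
    ... | no v∉S = contradiction (∈-deduplicate⁺ _≟ᵂ_ (∈-filter⁺ (_∉? S) v∈evens v∉S)) v∉D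
      where v∈evens = subst (λ b → v ∈ permsOfParity n b) v-even (permsOfParity-complete n pv)

    no-cycle : ∀ x r → ¬ CycleAvoiding D x r
    no-cycle x [] (() , _)
    no-cycle x (_ ∷ []) (s≤s () , _)
    no-cycle x (r₁ ∷ r₂ ∷ rest)
      ( _ , (_ ∷ x≢r₂ ∷ _) ∷ (_ ∷ r₁∉rest) ∷ _ , px ∷ p₁ ∷ p₂ ∷ rest-perm
      , x∉D ∷ r₁∉D ∷ r₂∉D ∷ rest∉D , x~r₁ , r₁~r₂ , chain) with oddInversions r₁ in r₁-parity
    ... | true =
      x≢r₂ (S-scattered (even∉D⇒∈S px x-even x∉D) (even∉D⇒∈S p₂ r₂-even r₂∉D) x~r₁ r₁~r₂)
      where
      x-even = trans (adjacent-parity p₁ (Adj-sym x~r₁)) (cong not r₁-parity)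
      r₂-even = trans (adjacent-parity p₁ r₁~r₂) (cong not r₁-parity)
    ... | false = next rest r₁∉rest rest-perm rest∉D chain
      where
      r₁∈S = even∉D⇒∈S p₁ r₁-parity r₁∉D
      r₂-odd = trans (adjacent-parity p₁ r₁~r₂) (cong not r₁-parity)
      -- the vertex after r₂ is x, odd like r₂, or an even r₃ ∈ S sharing the neighbour r₂ with r₁
      next : ∀ rest → All.All (r₁ ≢_) rest → All.All IsPerm rest → All.All (_∉ D) rest →
             Chain (r₂ ∷ rest ++ [ x ]) → ⊥
      next [] _ _ _ (r₂~x , _) with trans (adjacent-parity p₂ r₂~x) (cong not r₂-odd)
                                  | trans (adjacent-parity p₁ (Adj-sym x~r₁)) (cong not r₁-parity)
      ... | x-even | x-odd = contradiction (trans (sym x-odd) x-even) λ ()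
      next (r₃ ∷ _) (r₁≢r₃ ∷ _) (p₃ ∷ _) (r₃∉D ∷ _) (r₂~r₃ , _) =
        r₁≢r₃ (S-scattered r₁∈S (even∉D⇒∈S p₃ r₃-even r₃∉D) r₁~r₂ r₂~r₃)
        where r₃-even = trans (adjacent-parity p₂ r₂~r₃) (cong not r₂-odd)

    length-D+S : length D + length S ≤ length evens
    length-D+S = ≤-trans
      (+-mono-≤ (length-deduplicate _≟ᵂ_ (filter (_∉? S) evens)) (Unique-⊆⇒length≤ S-unique S⊆kept))
      (≤-reflexive (trans (+-comm (length (filter (_∉? S) evens)) _) (length-filter-∁ (_∈? S) evens)))
      where
      S⊆kept : S ⊆ filter (_∈? S) evens
      S⊆kept {s} s∈S = ∈-filter⁺ (_∈? S) s∈evens s∈S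
        where
        s∈evens = subst (λ b → s ∈ permsOfParity n b) (proj₂ (S-even s∈S))
                        (permsOfParity-complete n (proj₁ (S-even s∈S)))

  scattered⇒decyclingComplement : Σ (List (Word n)) λ D →
    IsDecyclingSet n D × length D + length S ≤ length (permsOfParity n false)
  scattered⇒decyclingComplement = D , (deduplicate-! _≟ᵂ_ (filter (_∉? S) evens) , D-perms , no-cycle) , length-D+S
    where
    D-perms : All.All IsPerm D
    D-perms = deduplicate⁺ _≟ᵂ_ (filter⁺ (_∉? S) (All.tabulate (proj₁ ∘ permsOfParity-sound n false)))

open ScatteredEvenSet

decyclingNumber+scattered≤ : ∀ {n d} → IsDecyclingNumber n d → (S : ScatteredEvenSet n) →
                             d + length (vertices S) ≤ length (permsOfParity n false)
decyclingNumber+scattered≤ (_ , minimal) S with scattered⇒decyclingComplement S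
... | D , D-decycling , length-D+S = ≤-trans (+-monoˡ-≤ _ (minimal D D-decycling)) length-D+S

noCommonNeighbour-∷ : ∀ {S : List (Word n)} {e} → NoCommonNeighbour S →
  (∀ {s c} → s ∈ S → Adj s c → Adj c e → ⊥) → NoCommonNeighbour (e ∷ S)
noCommonNeighbour-∷ S-scattered e-far (here refl) (here refl) _ _ = refl
noCommonNeighbour-∷ S-scattered e-far (here refl) (there b∈S) a~c c~b =
  ⊥-elim (e-far b∈S (Adj-sym c~b) (Adj-sym a~c))
noCommonNeighbour-∷ S-scattered e-far (there a∈S) (here refl) a~c c~b = ⊥-elim (e-far a∈S a~c c~b)
noCommonNeighbour-∷ S-scattered e-far (there a∈S) (there b∈S) a~c c~b = S-scattered a∈S b∈S a~c c~b


-- Parity-preserving permutations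

ParityPreserving : Vec (Fin k) m → Set
ParityPreserving w = ∀ p → odd (toℕ (lookup w p)) ≡ odd (toℕ p)

Mismatch : Vec (Fin k) m → Fin m → Set
Mismatch w p = odd (toℕ (lookup w p)) ≢ odd (toℕ p)

Successive : Vec (Fin k) m → Fin m → Fin m → Set
Successive w p q = toℕ (lookup w q) ≡ suc (toℕ (lookup w p))

StartsWithSuccessor : Vec (Fin k) (2 + m) → Set
StartsWithSuccessor w = Successive w zero (suc zero)

mismatch-swapᵥ : ∀ (i j p : Fin m) (w : Vec (Fin k) m) →
                 Mismatch (swapᵥ i j w) p → p ≡ i ⊎ p ≡ j ⊎ Mismatch w p
mismatch-swapᵥ i j p w mismatch with swapᵥ-support i j p w
... | inj₁ p≡i = inj₁ p≡i
... | inj₂ (inj₁ p≡j) = inj₂ (inj₁ p≡j)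
... | inj₂ (inj₂ same) = inj₂ (inj₂ (mismatch ∘ trans (cong (odd ∘ toℕ) same)))

mismatch-swapᵥ⁻ : ∀ (i j p : Fin m) (w : Vec (Fin k) m) →
                  Mismatch w p → p ≡ i ⊎ p ≡ j ⊎ Mismatch (swapᵥ i j w) p
mismatch-swapᵥ⁻ i j p w mismatch =
  mismatch-swapᵥ i j p (swapᵥ i j w) (subst (λ v → Mismatch v p) (sym (swapᵥ-involutive i j w)) mismatch)

parityPreserving-swapᵥ : ∀ (i j : Fin m) {w : Vec (Fin k) m} → odd (toℕ i) ≡ odd (toℕ j) →
                         ParityPreserving w → ParityPreserving (swapᵥ i j w)
parityPreserving-swapᵥ i j {w} i∼j pp p with swapᵥ-support i j p w
... | inj₁ refl = trans (cong (odd ∘ toℕ) (lookup-swapᵥ-left p j w)) (trans (pp j) (sym i∼j))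
... | inj₂ (inj₁ refl) = trans (cong (odd ∘ toℕ) (lookup-swapᵥ-right i p w)) (trans (pp i) i∼j)
... | inj₂ (inj₂ same) = trans (cong (odd ∘ toℕ) same) (pp p)

-- adjacent positions have different parities, so only the transpositions (0, j) can keep parity
InT-sameParity⇒zero : ∀ {i j : Fin (suc n)} → InT i j → odd (toℕ i) ≡ odd (toℕ j) → i ≡ zero
InT-sameParity⇒zero (inj₁ (i≡0 , _)) _ = toℕ-injective i≡0
InT-sameParity⇒zero (inj₂ (_ , j≡1+i)) i∼j = contradiction (trans i∼j (cong odd j≡1+i)) (not-¬ refl)

collision-mixedParity : ∀ (i j k l : Fin m) {s : Vec (Fin k′) m} → InT i j → InT k l →
  odd (toℕ i) ≢ odd (toℕ j) → ParityPreserving s → ParityPreserving (swapᵥ k l (swapᵥ i j s)) →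
  swapᵥ k l (swapᵥ i j s) ≡ s
collision-mixedParity i j k l {s} ij∈T kl∈T i≁j pp pp′ = placed (covered i i-mismatch) (covered j j-mismatch)
  where
  i-mismatch : Mismatch (swapᵥ i j s) i
  i-mismatch e = i≁j (sym (trans (sym (pp j)) (trans (cong (odd ∘ toℕ) (sym (lookup-swapᵥ-left i j s))) e)))
  j-mismatch : Mismatch (swapᵥ i j s) j
  j-mismatch e = i≁j (trans (sym (pp i)) (trans (cong (odd ∘ toℕ) (sym (lookup-swapᵥ-right i j s))) e))
  covered : ∀ p → Mismatch (swapᵥ i j s) p → p ≡ k ⊎ p ≡ l
  covered p mismatch with mismatch-swapᵥ⁻ k l p (swapᵥ i j s) mismatch
  ... | inj₁ p≡k = inj₁ p≡k
  ... | inj₂ (inj₁ p≡l) = inj₂ p≡l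
  ... | inj₂ (inj₂ mismatch′) = contradiction (pp′ p) mismatch′
  placed : i ≡ k ⊎ i ≡ l → j ≡ k ⊎ j ≡ l → swapᵥ k l (swapᵥ i j s) ≡ s
  placed (inj₁ refl) (inj₁ refl) = contradiction (InT⇒< ij∈T) (<-irrefl refl)
  placed (inj₁ refl) (inj₂ refl) = swapᵥ-involutive i j s
  placed (inj₂ refl) (inj₁ refl) = contradiction (InT⇒< kl∈T) (<-asym (InT⇒< ij∈T))
  placed (inj₂ refl) (inj₂ refl) = contradiction (InT⇒< ij∈T) (<-irrefl refl)

swapFirst-twice-breaksSuccessor : ∀ (j l : Fin (2 + n)) {s : Word (2 + n)} → IsPerm s → StartsWithSuccessor s →
  odd (toℕ j) ≡ false → odd (toℕ l) ≡ false → l ≢ zero → l ≢ j →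
  ¬ StartsWithSuccessor (swapᵥ zero l (swapᵥ zero j s))
swapFirst-twice-breaksSuccessor j l {s} ps succ j-even l-even l≢0 l≢j succ′ =
  l≢0 (perm-lookup-injective ps l zero (toℕ-injective (ℕ.suc-injective (begin
    suc (toℕ (lookup s l))     ≡⟨ cong (suc ∘ toℕ) s′₀ ⟨
    suc (toℕ (lookup s′ zero)) ≡⟨ succ′ ⟨
    toℕ (lookup s′ one)        ≡⟨ cong toℕ s′₁ ⟩
    toℕ (lookup s one)         ≡⟨ succ ⟩
    suc (toℕ (lookup s zero))  ∎))))
  where
  open ≡-Reasoning
  one : Fin (2 + _)
  one = suc zero
  o = swapᵥ zero j s
  s′ = swapᵥ zero l o
  even≢one : ∀ {p : Fin (2 + _)} → odd (toℕ p) ≡ false → one ≢ p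
  even≢one p-even refl = contradiction p-even λ ()
  s′₁ : lookup s′ one ≡ lookup s one
  s′₁ = trans (lookup-swapᵥ-other zero l one o (λ ()) (even≢one l-even))
              (lookup-swapᵥ-other zero j one s (λ ()) (even≢one j-even))
  s′₀ : lookup s′ zero ≡ lookup s l
  s′₀ = trans (lookup-swapᵥ-left zero l o) (lookup-swapᵥ-other zero j l s l≢0 l≢j)

collision-sameParity : ∀ (j k l : Fin (2 + n)) {s : Word (2 + n)} → InT k l → IsPerm s →
  ParityPreserving s → StartsWithSuccessor s → odd (toℕ j) ≡ false →
  ParityPreserving (swapᵥ k l (swapᵥ zero j s)) → StartsWithSuccessor (swapᵥ k l (swapᵥ zero j s)) →
  swapᵥ k l (swapᵥ zero j s) ≡ s
collision-sameParity j k l {s} kl∈T ps pp succ j-even pp′ succ′ with odd (toℕ k) Bool.≟ odd (toℕ l)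
... | no k≁l = ⊥-elim (k≁l (sym (begin
  odd (toℕ l)                        ≡⟨ o-pp l ⟨
  odd (toℕ (lookup o l))             ≡⟨ cong (odd ∘ toℕ) (lookup-swapᵥ-left k l o) ⟨
  odd (toℕ (lookup (swapᵥ k l o) k)) ≡⟨ pp′ k ⟩
  odd (toℕ k)                        ∎)))
  where
  open ≡-Reasoning
  o = swapᵥ zero j s
  o-pp = parityPreserving-swapᵥ zero j {s} (sym j-even) pp
... | yes k∼l with InT-sameParity⇒zero kl∈T k∼l
... | refl with l ≟ j
...   | yes refl = swapᵥ-involutive zero l s
...   | no l≢j = contradiction succ′ (swapFirst-twice-breaksSuccessor j l ps succ j-even (sym k∼l) l≢0 l≢j)
  where
  l≢0 : l ≢ zero
  l≢0 l≡0 = contradiction (subst (λ x → 0 < toℕ x) l≡0 (InT⇒< kl∈T)) λ ()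

parityPreserving-collision : ∀ {s s′ c : Word (2 + n)} → IsPerm s → ParityPreserving s → StartsWithSuccessor s →
  ParityPreserving s′ → StartsWithSuccessor s′ → Adj s c → Adj c s′ → s ≡ s′
parityPreserving-collision {s = s} ps pp succ pp′ succ′ (i , j , ij∈T , refl) (k , l , kl∈T , refl)
  with odd (toℕ i) Bool.≟ odd (toℕ j)
... | no i≁j = sym (collision-mixedParity i j k l ij∈T kl∈T i≁j pp pp′)
... | yes i∼j with InT-sameParity⇒zero ij∈T i∼j
... | refl = sym (collision-sameParity j k l kl∈T ps pp succ (sym i∼j) pp′ succ′)

ParityPreservingPerm : Word (2 + n) → Set
ParityPreservingPerm s = IsPerm s × ParityPreserving s × StartsWithSuccessor s

parityPreserving-noCommonNeighbour : ∀ {S : List (Word (2 + n))} →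
  (∀ {s} → s ∈ S → ParityPreservingPerm s) → NoCommonNeighbour S
parityPreserving-noCommonNeighbour S-pp a∈S b∈S a~c c~b with S-pp a∈S | S-pp b∈S
... | pa , ppa , succa | _ , ppb , succb = parityPreserving-collision pa ppa succa ppb succb a~c c~b

mismatch-swapᵥ² : ∀ (i j k l : Fin m) {s : Vec (Fin k′) m} → ParityPreserving s →
                  ∀ p → Mismatch (swapᵥ k l (swapᵥ i j s)) p → p ∈ᵥ (i ∷ j ∷ k ∷ l ∷ [])
mismatch-swapᵥ² i j k l {s} pp p mismatch with mismatch-swapᵥ k l p (swapᵥ i j s) mismatch
... | inj₁ p≡k = thereᵥ (thereᵥ (hereᵥ p≡k))
... | inj₂ (inj₁ p≡l) = thereᵥ (thereᵥ (thereᵥ (hereᵥ p≡l)))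
... | inj₂ (inj₂ mismatch′) with mismatch-swapᵥ i j p s mismatch′
...   | inj₁ p≡i = hereᵥ p≡i
...   | inj₂ (inj₁ p≡j) = thereᵥ (hereᵥ p≡j)
...   | inj₂ (inj₂ mismatch″) = contradiction (pp p) mismatch″

-- two transpositions move at most four entries
fiveMismatches⇒noCommonNeighbour : ∀ {s c e : Word n} (f : Fin 5 → Fin n) →
  (∀ {p q} → f p ≡ f q → p ≡ q) → (∀ p → Mismatch e (f p)) → ParityPreserving s → Adj s c → Adj c e → ⊥
fiveMismatches⇒noCommonNeighbour {s = s} f f-injective e-mismatch pp (i , j , _ , refl) (k , l , _ , refl) =
  pigeonhole-∈ᵥ (s≤s (s≤s (s≤s (s≤s (s≤s z≤n))))) (i ∷ j ∷ k ∷ l ∷ []) f f-injective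
    (λ p → mismatch-swapᵥ² i j k l {s} pp (f p) (e-mismatch p))

module _ (t : ℕ) where

  private
    e₁ : Word (6 + t)
    e₁ = swapᵥ (# 1) (# 2) (swapᵥ (# 0) (# 1) (identity (6 + t)))

    perm-e₁ : IsPerm e₁
    perm-e₁ = perm-swapᵥ (# 1) (# 2) (perm-swapᵥ (# 0) (# 1) (perm-identity (6 + t)))

  -- the entries 1 2 3 0 5 at positions 0 … 4 all have the wrong parity
  farVertex : Word (6 + t)
  farVertex = swapᵥ (# 4) (# 5) (swapᵥ (# 2) (# 3) e₁)

  perm-farVertex : IsPerm farVertex
  perm-farVertex = perm-swapᵥ (# 4) (# 5) (perm-swapᵥ (# 2) (# 3) perm-e₁)

  farVertex-even : oddInversions farVertex ≡ false
  farVertex-even = begin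
    oddInversions farVertex
      ≡⟨ oddInversions-swapᵥ² (# 2) (# 3) (# 4) (# 5) perm-e₁ (inj₂ (s≤s z≤n , refl)) (inj₂ (s≤s z≤n , refl)) ⟩
    oddInversions e₁
      ≡⟨ oddInversions-swapᵥ² (# 0) (# 1) (# 1) (# 2) (perm-identity (6 + t))
                              (inj₁ (refl , s≤s z≤n)) (inj₂ (s≤s z≤n , refl)) ⟩
    oddInversions (identity (6 + t))
      ≡⟨ oddInversions-identity (6 + t) ⟩
    false ∎
    where open ≡-Reasoning

  farVertex-mismatch : ∀ (p : Fin 5) → Mismatch farVertex (p ↑ˡ suc t)
  farVertex-mismatch zero ()
  farVertex-mismatch (suc zero) ()
  farVertex-mismatch (suc (suc zero)) ()
  farVertex-mismatch (suc (suc (suc zero))) ()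
  farVertex-mismatch (suc (suc (suc (suc zero)))) ()

  farVertex-far : ∀ {s c} → ParityPreserving s → Adj s c → Adj c farVertex → ⊥
  farVertex-far = fiveMismatches⇒noCommonNeighbour (_↑ˡ suc t) (↑ˡ-injective (suc t) _ _) farVertex-mismatch


-- Paired block permutations

double : ℕ → ℕ
double zero = zero
double (suc m) = suc (suc (double m))

odd-double : ∀ m → odd (double m) ≡ false
odd-double zero = refl
odd-double (suc m) = trans (not-involutive (odd (double m))) (odd-double m)

evenPosition : Fin (suc m) → Fin (suc (double m))
evenPosition zero = zero
evenPosition {suc m} (suc a) = suc (suc (evenPosition a))

evenPosition-injective : ∀ {a b : Fin (suc m)} → evenPosition a ≡ evenPosition b → a ≡ b
evenPosition-injective {a = zero} {zero} _ = refl
evenPosition-injective {suc m} {zero} {suc b} ()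
evenPosition-injective {suc m} {suc a} {zero} ()
evenPosition-injective {suc m} {suc a} {suc b} eq =
  cong suc (evenPosition-injective (Fin.suc-injective (Fin.suc-injective eq)))

odd-positionsAfter-evenPosition : ∀ (a : Fin (suc m)) → odd (positionsAfter (evenPosition a)) ≡ false
odd-positionsAfter-evenPosition {m} zero = odd-double m
odd-positionsAfter-evenPosition {suc m} (suc a) = odd-positionsAfter-evenPosition a

-- the values 2m and 2m + 1 are inserted at positions 2a and 2a + 1
insertPair : Fin (suc m) → Word (double m) → Word (double (suc m))
insertPair a w = insertMax (suc (evenPosition a)) (insertMax (evenPosition a) w)

pairedPerms : ∀ m → List (Word (double m))
pairedPermsWithPairAt : Fin (suc m) → List (Word (double (suc m)))

pairedPerms zero = [ [] ]
pairedPerms (suc m) = concatMap pairedPermsWithPairAt (allFin (suc m))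

pairedPermsWithPairAt {m} a = List.map (insertPair a) (pairedPerms m)

PairedBlocks : ∀ m → Vec (Fin k) (double m) → Set
PairedBlocks zero [] = ⊤
PairedBlocks (suc m) (x ∷ y ∷ xs) = odd (toℕ x) ≡ false × toℕ y ≡ suc (toℕ x) × PairedBlocks m xs

pairedBlocks-map-inject₁ : ∀ m (w : Vec (Fin k) (double m)) → PairedBlocks m w → PairedBlocks m (map inject₁ w)
pairedBlocks-map-inject₁ zero [] _ = tt
pairedBlocks-map-inject₁ (suc m) (x ∷ y ∷ w) (x-even , y≡1+x , rest) =
  trans (cong odd (toℕ-inject₁ x)) x-even ,
  trans (toℕ-inject₁ y) (trans y≡1+x (cong suc (sym (toℕ-inject₁ x)))) ,
  pairedBlocks-map-inject₁ m w rest

pairedBlocks-insertAt : ∀ m (xs : Vec (Fin k) (double m)) (a : Fin (suc m)) {v₁ v₂} → PairedBlocks m xs →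
  odd (toℕ v₁) ≡ false → toℕ v₂ ≡ suc (toℕ v₁) →
  PairedBlocks (suc m) (insertAt (insertAt xs (evenPosition a) v₁) (suc (evenPosition a)) v₂)
pairedBlocks-insertAt m xs zero xs-paired v₁-even v₂≡1+v₁ = v₁-even , v₂≡1+v₁ , xs-paired
pairedBlocks-insertAt (suc m) (x ∷ y ∷ xs) (suc a) (x-even , y≡1+x , rest) v₁-even v₂≡1+v₁ =
  x-even , y≡1+x , pairedBlocks-insertAt m xs a rest v₁-even v₂≡1+v₁

pairedBlocks-insertPair : ∀ m (a : Fin (suc m)) (w : Word (double m)) → PairedBlocks m w →
                          PairedBlocks (suc m) (insertPair a w)
pairedBlocks-insertPair m a w w-paired =
  subst (PairedBlocks (suc m))
        (cong (λ v → insertAt v (suc e) M₂) (sym (map-insertAt inject₁ M₁ (map inject₁ w) e)))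
    (pairedBlocks-insertAt m (map inject₁ (map inject₁ w)) a
      (pairedBlocks-map-inject₁ m _ (pairedBlocks-map-inject₁ m w w-paired))
      (trans (cong odd M₁-value) (odd-double m))
      (trans (toℕ-fromℕ (suc (double m))) (cong suc (sym M₁-value))))
  where
  e = evenPosition a
  M₁ = fromℕ (double m)
  M₂ = fromℕ (suc (double m))
  M₁-value : toℕ (inject₁ M₁) ≡ double m
  M₁-value = trans (toℕ-inject₁ M₁) (toℕ-fromℕ (double m))

oddInversions-insertPair : ∀ (a : Fin (suc m)) (w : Word (double m)) → oddInversions (insertPair a w) ≡ oddInversions w
oddInversions-insertPair a w = begin
  oddInversions (insertPair a w)
    ≡⟨ oddInversions-insertMax (suc (evenPosition a)) (insertMax (evenPosition a) w) ⟩
  o xor oddInversions (insertMax (evenPosition a) w)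
    ≡⟨ cong (o xor_) (oddInversions-insertMax (evenPosition a) w) ⟩
  o xor (o xor oddInversions w)
    ≡⟨ cong (λ b → b xor (b xor oddInversions w)) (odd-positionsAfter-evenPosition a) ⟩
  oddInversions w ∎
  where
  open ≡-Reasoning
  o = odd (positionsAfter (evenPosition a))

insertPair-injective : ∀ {a b : Fin (suc m)} {w v : Word (double m)} →
                       insertPair a w ≡ insertPair b v → a ≡ b × w ≡ v
insertPair-injective eq =
  let outer-position , inner≡ = insertMax-injective eq
      inner-position , w≡v = insertMax-injective inner≡
  in evenPosition-injective inner-position , w≡v

pairedPerms-sound : ∀ m {s} → s ∈ pairedPerms m → IsPerm s × oddInversions s ≡ false × PairedBlocks m s
pairedPerms-sound zero (here refl) = (λ ()) , refl , tt
pairedPerms-sound (suc m) s∈ with satisfied (∈-concatMap⁻ pairedPermsWithPairAt {xs = allFin (suc m)} s∈)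
... | a , s∈block with ∈-map⁻ (insertPair a) s∈block
... | w , w∈ , refl with pairedPerms-sound m w∈
... | pw , w-even , w-paired =
  perm-insertMax (suc (evenPosition a)) (perm-insertMax (evenPosition a) pw) ,
  trans (oddInversions-insertPair a w) w-even ,
  pairedBlocks-insertPair m a w w-paired

pairedPerms-unique : ∀ m → Unique (pairedPerms m)
pairedPerms-unique zero = [] ∷ []
pairedPerms-unique (suc m) = Unique-concatMap pairedPermsWithPairAt (allFin⁺ (suc m))
  (λ a → Unique-map⁺ (proj₂ ∘ insertPair-injective) (pairedPerms-unique m))
  λ z∈block-a z∈block-b →
    let w , _ , z≡ = ∈-map⁻ (insertPair _) z∈block-a
        v , _ , z≡′ = ∈-map⁻ (insertPair _) z∈block-b
    in proj₁ (insertPair-injective (trans (sym z≡) z≡′))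

length-pairedPerms : ∀ m → length (pairedPerms m) ≡ m !
length-pairedPerms zero = refl
length-pairedPerms (suc m) = begin
  length (pairedPerms (suc m))
    ≡⟨ length-concatMap-const pairedPermsWithPairAt (allFin (suc m)) (m !) length-block ⟩
  length (allFin (suc m)) * m !     ≡⟨ cong (_* m !) (length-tabulate {n = suc m} (λ i → i)) ⟩
  suc m * m !                       ∎
  where
  open ≡-Reasoning
  length-block : ∀ a → length (pairedPermsWithPairAt a) ≡ m !
  length-block a = trans (length-map (insertPair a) (pairedPerms m)) (length-pairedPerms m)

paired⇒parityPreserving : ∀ m (w : Vec (Fin k) (double m)) → PairedBlocks m w → ParityPreserving w
paired⇒parityPreserving (suc m) (x ∷ y ∷ w) (x-even , _ , _) zero = x-even
paired⇒parityPreserving (suc m) (x ∷ y ∷ w) (x-even , y≡1+x , _) (suc zero) =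
  trans (cong odd y≡1+x) (cong not x-even)
paired⇒parityPreserving (suc m) (x ∷ y ∷ w) (_ , _ , rest) (suc (suc p)) =
  trans (paired⇒parityPreserving m w rest p) (sym (not-involutive (odd (toℕ p))))

paired⇒startsWithSuccessor : ∀ m (w : Vec (Fin k) (double (suc m))) → PairedBlocks (suc m) w → StartsWithSuccessor w
paired⇒startsWithSuccessor m (x ∷ y ∷ w) (_ , y≡1+x , _) = y≡1+x

paired⇒successive₂₃ : ∀ m (w : Vec (Fin k) (double (2 + m))) → PairedBlocks (2 + m) w → Successive w (# 2) (# 3)
paired⇒successive₂₃ m (_ ∷ _ ∷ x ∷ y ∷ w) (_ , _ , _ , y≡1+x , _) = y≡1+x

pairedPerms-parityPreserving : ∀ m {s} → s ∈ pairedPerms (suc m) → ParityPreservingPerm s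
pairedPerms-parityPreserving m {s} s∈ with pairedPerms-sound (suc m) s∈
... | ps , _ , s-paired = ps , paired⇒parityPreserving (suc m) s s-paired , paired⇒startsWithSuccessor m s s-paired


appendMax : Word n → Word (suc n)
appendMax {n} = insertMax (fromℕ n)

toℕ-lookup-appendMax : ∀ (w : Word n) q → toℕ (lookup (appendMax w) (inject₁ q)) ≡ toℕ (lookup w q)
toℕ-lookup-appendMax {n} w q = begin
  toℕ (lookup (appendMax w) (inject₁ q)) ≡⟨ cong toℕ (lookup-insertAt-fromℕ (map inject₁ w) (fromℕ n) q) ⟩
  toℕ (lookup (map inject₁ w) q)         ≡⟨ cong toℕ (lookup-map q inject₁ w) ⟩
  toℕ (inject₁ (lookup w q))             ≡⟨ toℕ-inject₁ (lookup w q) ⟩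
  toℕ (lookup w q)                       ∎
  where open ≡-Reasoning

oddInversions-appendMax : ∀ (w : Word n) → oddInversions (appendMax w) ≡ oddInversions w
oddInversions-appendMax {n} w =
  trans (oddInversions-insertMax (fromℕ n) w) (cong (λ a → odd a xor oddInversions w) (positionsAfter-fromℕ n))
  where
  positionsAfter-fromℕ : ∀ n → positionsAfter (fromℕ n) ≡ 0
  positionsAfter-fromℕ zero = refl
  positionsAfter-fromℕ (suc n) = positionsAfter-fromℕ n

-- the new maximum n sits at position n
parityPreserving-appendMax : ∀ {w : Word n} → ParityPreserving w → ParityPreserving (appendMax w)
parityPreserving-appendMax {n} {w} pp p with view p
... | ‵fromℕ = cong (odd ∘ toℕ) (insertAt-lookup (map inject₁ w) (fromℕ n) (fromℕ n))
... | ‵inject₁ q = trans (cong odd (toℕ-lookup-appendMax w q)) (trans (pp q) (cong odd (sym (toℕ-inject₁ q))))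

successive-appendMax : ∀ {w : Word n} {p q} → Successive w p q → Successive (appendMax w) (inject₁ p) (inject₁ q)
successive-appendMax {w = w} {p} {q} w-succ =
  trans (toℕ-lookup-appendMax w q) (trans w-succ (cong suc (sym (toℕ-lookup-appendMax w p))))

rotate : ∀ {t} → Vec A (7 + t) → Vec A (7 + t)
rotate (a₀ ∷ a₁ ∷ a₂ ∷ a₃ ∷ a₄ ∷ a₅ ∷ a₆ ∷ r) = a₀ ∷ a₁ ∷ a₆ ∷ a₃ ∷ a₂ ∷ a₅ ∷ a₄ ∷ r

module _ {t : ℕ} where

  rotate≡swaps : ∀ (v : Vec A (7 + t)) →
    rotate v ≡ swapᵥ (# 0) (# 2) (swapᵥ (# 0) (# 6) (swapᵥ (# 0) (# 4) (swapᵥ (# 0) (# 2) v)))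
  rotate≡swaps (a₀ ∷ a₁ ∷ a₂ ∷ a₃ ∷ a₄ ∷ a₅ ∷ a₆ ∷ r) = refl

  rotate-injective : ∀ {v v′ : Vec A (7 + t)} → rotate v ≡ rotate v′ → v ≡ v′
  rotate-injective {v = _ ∷ _ ∷ _ ∷ _ ∷ _ ∷ _ ∷ _ ∷ _} {_ ∷ _ ∷ _ ∷ _ ∷ _ ∷ _ ∷ _ ∷ _} refl = refl

  perm-rotate : ∀ {v : Word (7 + t)} → IsPerm v → IsPerm (rotate v)
  perm-rotate {v} pv = subst IsPerm (sym (rotate≡swaps v))
    (perm-swapᵥ (# 0) (# 2) (perm-swapᵥ (# 0) (# 6) (perm-swapᵥ (# 0) (# 4) (perm-swapᵥ (# 0) (# 2) pv))))

  oddInversions-rotate : ∀ {v : Word (7 + t)} → IsPerm v → oddInversions (rotate v) ≡ oddInversions v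
  oddInversions-rotate {v} pv = begin
    oddInversions (rotate v)                                 ≡⟨ cong oddInversions (rotate≡swaps v) ⟩
    oddInversions (swapᵥ (# 0) (# 2) (swapᵥ (# 0) (# 6) v₂)) ≡⟨ oddInversions-swapᵥ² (# 0) (# 6) (# 0) (# 2) pv₂ 0-6 0-2 ⟩
    oddInversions v₂                                         ≡⟨ oddInversions-swapᵥ² (# 0) (# 2) (# 0) (# 4) pv 0-2 0-4 ⟩
    oddInversions v                                          ∎
    where
    open ≡-Reasoning
    v₂ = swapᵥ (# 0) (# 4) (swapᵥ (# 0) (# 2) v)
    pv₂ = perm-swapᵥ (# 0) (# 4) (perm-swapᵥ (# 0) (# 2) pv)
    0-2 : InT {7 + t} (# 0) (# 2)
    0-2 = inj₁ (refl , s≤s z≤n)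
    0-4 : InT {7 + t} (# 0) (# 4)
    0-4 = inj₁ (refl , s≤s z≤n)
    0-6 : InT {7 + t} (# 0) (# 6)
    0-6 = inj₁ (refl , s≤s z≤n)

  parityPreserving-rotate : ∀ {v : Vec (Fin k) (7 + t)} → ParityPreserving v → ParityPreserving (rotate v)
  parityPreserving-rotate {v = v} pp = subst ParityPreserving (sym (rotate≡swaps v))
    (parityPreserving-swapᵥ (# 0) (# 2) {v₃} refl (parityPreserving-swapᵥ (# 0) (# 6) {v₂} refl
      (parityPreserving-swapᵥ (# 0) (# 4) {v₁} refl (parityPreserving-swapᵥ (# 0) (# 2) {v} refl pp))))
    where
    v₁ = swapᵥ (# 0) (# 2) v
    v₂ = swapᵥ (# 0) (# 4) v₁
    v₃ = swapᵥ (# 0) (# 6) v₂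

  startsWithSuccessor-rotate : ∀ {v : Vec (Fin k) (7 + t)} → StartsWithSuccessor v → StartsWithSuccessor (rotate v)
  startsWithSuccessor-rotate {v = _ ∷ _ ∷ _ ∷ _ ∷ _ ∷ _ ∷ _ ∷ _} v-succ = v-succ

  rotate-breaks-successive₂₃ : ∀ {v : Word (7 + t)} → IsPerm v → Successive v (# 2) (# 3) →
                               ¬ Successive (rotate v) (# 2) (# 3)
  rotate-breaks-successive₂₃ {v@(_ ∷ _ ∷ _ ∷ _ ∷ _ ∷ _ ∷ _ ∷ _)} pv v-succ rotated-succ =
    contradiction (perm-lookup-injective pv (# 6) (# 2) (toℕ-injective a₆≡a₂)) λ ()
    where a₆≡a₂ = ℕ.suc-injective (trans (sym rotated-succ) v-succ)


evenScatteredSet : ∀ m → ScatteredEvenSet (double (3 + m))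
evenScatteredSet m = record
  { vertices = farVertex (double m) ∷ pairedPerms (3 + m)
  ; vertices-unique = far∉paired ∷ pairedPerms-unique (3 + m)
  ; vertices-even = λ where
      (here refl) → perm-farVertex (double m) , farVertex-even (double m)
      (there s∈) → let ps , s-even , _ = pairedPerms-sound (3 + m) s∈ in ps , s-even
  ; vertices-scattered =
      noCommonNeighbour-∷ (parityPreserving-noCommonNeighbour (pairedPerms-parityPreserving (2 + m)))
                          λ s∈ → farVertex-far (double m) (parity-preserving s∈)
  }
  where
  parity-preserving : ∀ {s} → s ∈ pairedPerms (3 + m) → ParityPreserving s
  parity-preserving = proj₁ ∘ proj₂ ∘ pairedPerms-parityPreserving (2 + m)
  far∉paired : All.All (farVertex (double m) ≢_) (pairedPerms (3 + m))
  far∉paired = All.tabulate λ s∈ far≡s →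
    farVertex-mismatch (double m) zero (subst ParityPreserving (sym far≡s) (parity-preserving s∈) zero)

length-evenScatteredSet : ∀ m → length (vertices (evenScatteredSet m)) ≡ suc ((3 + m) !)
length-evenScatteredSet m = cong suc (length-pairedPerms (3 + m))

module _ (m : ℕ) where

  private
    firstHalf secondHalf : List (Word (suc (double (3 + m))))
    firstHalf = List.map appendMax (pairedPerms (3 + m))
    secondHalf = List.map rotate firstHalf

    EvenParityPreserving : Word (suc (double (3 + m))) → Set
    EvenParityPreserving v = ParityPreservingPerm v × oddInversions v ≡ false

    firstHalf-props : ∀ {v} → v ∈ firstHalf → EvenParityPreserving v × Successive v (# 2) (# 3)
    firstHalf-props v∈ with ∈-map⁻ appendMax v∈
    ... | w , w∈ , refl with pairedPerms-sound (3 + m) w∈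
    ... | pw , w-even , w-paired =
      ( ( perm-insertMax (fromℕ _) pw
        , parityPreserving-appendMax {w = w} (paired⇒parityPreserving (3 + m) w w-paired)
        , successive-appendMax {w = w} (paired⇒startsWithSuccessor (2 + m) w w-paired) )
      , trans (oddInversions-appendMax w) w-even )
      , successive-appendMax {w = w} (paired⇒successive₂₃ (1 + m) w w-paired)

    secondHalf-props : ∀ {v} → v ∈ secondHalf → EvenParityPreserving v × ¬ Successive v (# 2) (# 3)
    secondHalf-props v∈ with ∈-map⁻ rotate v∈
    ... | u , u∈ , refl with firstHalf-props u∈
    ... | ((pu , u-pp , u-succ) , u-even) , u-succ₂₃ =
      ( (perm-rotate pu , parityPreserving-rotate {v = u} u-pp , startsWithSuccessor-rotate {v = u} u-succ)
      , trans (oddInversions-rotate pu) u-even ) ,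
      rotate-breaks-successive₂₃ pu u-succ₂₃

    props : ∀ {v} → v ∈ firstHalf ++ secondHalf → EvenParityPreserving v
    props v∈ with ∈-++⁻ firstHalf v∈
    ... | inj₁ v∈first = proj₁ (firstHalf-props v∈first)
    ... | inj₂ v∈second = proj₁ (secondHalf-props v∈second)

    firstHalf-unique : Unique firstHalf
    firstHalf-unique = Unique-map⁺ (proj₂ ∘ insertMax-injective) (pairedPerms-unique (3 + m))

  -- rotating the entries at positions 2, 4, 6 breaks the block at positions 2, 3, so the halves are disjoint
  oddScatteredSet : ScatteredEvenSet (suc (double (3 + m)))
  oddScatteredSet = record
    { vertices = firstHalf ++ secondHalf
    ; vertices-unique = ++⁺ firstHalf-unique (Unique-map⁺ rotate-injective firstHalf-unique)
        λ (v∈first , v∈second) → proj₂ (secondHalf-props v∈second) (proj₂ (firstHalf-props v∈first))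
    ; vertices-even = λ v∈ → proj₁ (proj₁ (props v∈)) , proj₂ (props v∈)
    ; vertices-scattered = parityPreserving-noCommonNeighbour (proj₁ ∘ props)
    }

  length-oddScatteredSet : length (vertices oddScatteredSet) ≡ 2 * (3 + m) !
  length-oddScatteredSet = begin
    length (firstHalf ++ secondHalf)     ≡⟨ length-++ firstHalf ⟩
    length firstHalf + length secondHalf ≡⟨ cong (length firstHalf +_) (length-map rotate firstHalf) ⟩
    length firstHalf + length firstHalf  ≡⟨ cong (λ l → l + l) length-firstHalf ⟩
    (3 + m) ! + (3 + m) !                ≡⟨ cong ((3 + m) ! +_) (+-identityʳ ((3 + m) !)) ⟨
    2 * (3 + m) !                        ∎
    where
    open ≡-Reasoning
    length-firstHalf = trans (length-map appendMax (pairedPerms (3 + m))) (length-pairedPerms (3 + m))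


-- Bounds on the decycling number

double≡*2 : ∀ m → double m ≡ m * 2
double≡*2 zero = refl
double≡*2 (suc m) = cong (λ x → suc (suc x)) (double≡*2 m)

double/2 : ∀ m → double m / 2 ≡ m
double/2 m = trans (cong (_/ 2) (double≡*2 m)) (m*n/n≡m m 2)

double%2 : ∀ m → double m % 2 ≡ 0
double%2 m = trans (cong (_% 2) (double≡*2 m)) (m*n%n≡0 m 2)

suc-double%2 : ∀ m → suc (double m) % 2 ≡ 1
suc-double%2 m = trans (cong (λ x → suc x % 2) (double≡*2 m)) ([m+kn]%n≡m%n 1 m 2)

double⊎suc-double : ∀ n → ∃ λ m → n ≡ double m ⊎ n ≡ suc (double m)
double⊎suc-double zero = 0 , inj₁ refl
double⊎suc-double (suc n) with double⊎suc-double n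
... | m , inj₁ refl = m , inj₂ refl
... | m , inj₂ refl = suc m , inj₁ refl

length-evens : ∀ k → length (permsOfParity (2 + k) false) ≡ (2 + k) ! / 2
length-evens k = trans (length-permsOfParity k false)
                       (sym (trans (cong (_/ 2) (sym (halfFactorial-*2 k))) (m*n/n≡m (halfFactorial k) 2)))

even-bound : ∀ m {d} → 6 ≤ double m → IsDecyclingNumber (double m) d →
             d < double m ! / 2 ∸ (double m / 2) !
even-bound (suc (suc (suc m))) {d} _ d-min =
  subst (λ h → d < double (3 + m) ! / 2 ∸ h !) (sym (double/2 (3 + m))) (m+n≤o⇒m≤o∸n (suc d) (begin
    suc d + (3 + m) !                             ≡⟨ +-suc d ((3 + m) !) ⟨
    d + suc ((3 + m) !)                           ≡⟨ cong (d +_) (length-evenScatteredSet m) ⟨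
    d + length (vertices S)                       ≤⟨ decyclingNumber+scattered≤ d-min S ⟩
    length (permsOfParity (double (3 + m)) false) ≡⟨ length-evens (4 + double m) ⟩
    double (3 + m) ! / 2                          ∎))
  where
  open ≤-Reasoning
  S = evenScatteredSet m
even-bound zero ()
even-bound (suc zero) (s≤s (s≤s ()))
even-bound (suc (suc zero)) (s≤s (s≤s (s≤s (s≤s ()))))

odd-bound : ∀ m {d} → 6 ≤ suc (double m) → IsDecyclingNumber (suc (double m)) d →
            d < (suc (double m) ! / 2 ∸ 2 * ((suc (double m) ∸ 1) / 2) !) + 1
odd-bound (suc (suc (suc m))) {d} _ d-min =
  subst (λ h → d < (suc (double (3 + m)) ! / 2 ∸ 2 * h !) + 1) (sym (double/2 (3 + m)))
    (≤-trans (s≤s (m+n≤o⇒m≤o∸n d (begin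
      d + 2 * (3 + m) !                                   ≡⟨ cong (d +_) (length-oddScatteredSet m) ⟨
      d + length (vertices S)                             ≤⟨ decyclingNumber+scattered≤ d-min S ⟩
      length (permsOfParity (suc (double (3 + m))) false) ≡⟨ length-evens (5 + double m) ⟩
      suc (double (3 + m)) ! / 2                          ∎)))
    (≤-reflexive (+-comm 1 _)))
  where
  open ≤-Reasoning
  S = oddScatteredSet m
odd-bound zero (s≤s ())
odd-bound (suc zero) (s≤s (s≤s (s≤s ())))
odd-bound (suc (suc zero)) (s≤s (s≤s (s≤s (s≤s (s≤s ())))))

theorem4p1 : ∀ (n d : ℕ) → 6 ≤ n → IsDecyclingNumber n d →
    (n % 2 ≡ 0 → d < (n ! / 2) ∸ (n / 2) !)
    × (n % 2 ≡ 1 → d < ((n ! / 2) ∸ 2 * ((n ∸ 1) / 2) !) + 1)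
theorem4p1 n d 6≤n d-min with double⊎suc-double n
... | m , inj₁ refl =
  (λ _ → even-bound m 6≤n d-min) , λ n%2≡1 → contradiction (trans (sym n%2≡1) (double%2 m)) λ ()
... | m , inj₂ refl =
  (λ n%2≡0 → contradiction (trans (sym n%2≡0) (suc-double%2 m)) λ ()) , λ _ → odd-bound m 6≤n d-min
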